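{- For any synchronisation tree $T\in\mathsf{ST}_\infty(\mathsf{Act})$, any process $p$ of any transition system over $\mathsf{Act}$ and any ordinal $\lambda$ with $\mathsf{ht}(T)<\lambda$: $T\lesssim^{B}p\iff T\lesssim_\lambda p$.
   Context: A transition system is $(\mathrm{Proc},\mathsf{Act},\rightarrow,\uparrow)$ with ${\rightarrow}\subseteq\mathrm{Proc}\times\mathsf{Act}\times\mathrm{Proc}$ (written $p\xrightarrow{a}q$) and ${\uparrow}\subseteq\mathrm{Proc}$; $p\downarrow$ means not $p\uparrow$. Relations $\lesssim_\alpha$: $\lesssim_0$ is the total relation; $p\lesssim_{\alpha+1}q$ iff for all $a$: (1) $p\xrightarrow{a}p'$ implies $\exists q'.\,q\xrightarrow{a}q'\wedge p'\lesssim_\alpha q'$; (2) $p\downarrow$ implies $q\downarrow$ and ($q\xrightarrow{a}q'$ implies $\exists p'.\,p\xrightarrow{a}p'\wedge p'\lesssim_\alpha q'$); at limits take intersections. $\lesssim^B$ is the largest relation $R$ satisfying (1),(2) with $R$ in place of $\lesssim_\alpha$. Processes of different systems are compared in their disjoint union. Synchronisation trees $\mathsf{ST}_\infty(\mathsf{Act})$: the class of infinitary terms generated by: for any set $I$, $a_i\in\mathsf{Act}$ and trees $t_i$ ($i\in I$), both $\sum_{i\in I}a_it_i$ and $\sum_{i\in I}a_it_i+\Omega$ are trees. They form a transition system: $t\uparrow$ iff $\Omega$ is a summand of $t$, and $t\xrightarrow{a_i}t_i$ for each summand $a_it_i$. Height: $\mathsf{ht}(\sum_{i\in I}a_it_i\,[+\Omega])=\sup\{\mathsf{ht}(t_i):i\in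 I\}+1$. -}

module Defs where

open import Level using (Lift; lift)
open import Data.Bool using (Bool; true; false)
open import Data.Empty using (⊥)
open import Data.Unit using (⊤)
open import Data.Sum using (_⊎_; inj₁; inj₂)
open import Data.Product using (Σ; ∃; _×_; _,_)
open import Relation.Nullary using (¬_)
open import Relation.Binary.PropositionalEquality using (_≡_)

record LTS (Act : Set) : Set₂ where
  field
    Proc   : Set₁
    _⟶[_]_ : Proc → Act → Proc → Set₁
    _↑     : Proc → Set₁

  _↓ : Proc → Set₁
  p ↓ = ¬ (p ↑)

open LTS public using (Proc)

_⊎ᴸ_ : {Act : Set} → LTS Act → LTS Act → LTS Act
_⊎ᴸ_ {Act} S S' = record { Proc = Proc S ⊎ Proc S' ; _⟶[_]_ = tr ; _↑ = dv }
  where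
  tr : Proc S ⊎ Proc S' → Act → Proc S ⊎ Proc S' → Set₁
  tr (inj₁ p) a (inj₁ q) = LTS._⟶[_]_ S p a q
  tr (inj₂ p) a (inj₂ q) = LTS._⟶[_]_ S' p a q
  tr (inj₁ _) _ (inj₂ _) = Lift _ ⊥
  tr (inj₂ _) _ (inj₁ _) = Lift _ ⊥
  dv : Proc S ⊎ Proc S' → Set₁
  dv (inj₁ p) = LTS._↑ S p
  dv (inj₂ p) = LTS._↑ S' p

-- Synchronisation trees ST∞(Act):
-- node I a t false = Σ_{i∈I} a_i t_i ,  node I a t true = Σ_{i∈I} a_i t_i + Ω

data ST (Act : Set) : Set₁ where
  node : (I : Set) → (I → Act) → (I → ST Act) → Bool → ST Act

STLTS : (Act : Set) → LTS Act
STLTS Act = record { Proc = ST Act ; _⟶[_]_ = tr ; _↑ = dv }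
  where
  tr : ST Act → Act → ST Act → Set₁
  tr (node I a t _) c t' = Σ I λ i → (a i ≡ c) × (t i ≡ t')
  dv : ST Act → Set₁
  dv (node _ _ _ b) = Lift _ (b ≡ true)

-- Ordinals as Brouwer trees (limits over arbitrary index sets)

data Ord : Set₁ where
  ozero : Ord
  osuc  : Ord → Ord
  olim  : (I : Set) → (I → Ord) → Ord

data _≤ₒ_ : Ord → Ord → Set₁ where
  ≤-zero  : ∀ {x} → ozero ≤ₒ x
  ≤-trans : ∀ {x y z} → x ≤ₒ y → y ≤ₒ z → x ≤ₒ z
  ≤-suc   : ∀ {x y} → x ≤ₒ y → osuc x ≤ₒ osuc y
  ≤-cocone : ∀ {x I f} (k : I) → x ≤ₒ f k → x ≤ₒ olim I f
  ≤-limiting : ∀ {x I f} → (∀ k → f k ≤ₒ x) → olim I f ≤ₒ x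

_<ₒ_ : Ord → Ord → Set₁
x <ₒ y = osuc x ≤ₒ y

ht : {Act : Set} → ST Act → Ord
ht (node I a t b) = osuc (olim I (λ i → ht (t i)))

module _ {Act : Set} (S : LTS Act) where
  open LTS S renaming (Proc to P)

  -- clauses (1) and (2) with R in place of ≲_α
  Step : (P → P → Set₁) → P → P → Set₁
  Step R p q =
    (∀ a p' → p ⟶[ a ] p' → ∃ λ q' → (q ⟶[ a ] q') × R p' q')
    × (p ↓ → (q ↓) × (∀ a q' → q ⟶[ a ] q' → ∃ λ p' → (p ⟶[ a ] p') × R p' q'))

  _≲[_]_ : P → Ord → P → Set₁
  p ≲[ ozero ] q = Lift _ ⊤
  p ≲[ osuc α ] q = Step (λ x y → x ≲[ α ] y) p q
  p ≲[ olim I f ] q = ∀ i → p ≲[ f i ] q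

  -- ≲^B : the largest relation satisfying (1),(2) (union of all post-fixed points)
  _≲B_ : P → P → Set₂
  p ≲B q = Σ (P → P → Set₁) λ R → (∀ x y → R x y → Step R x y) × R p q

module Submission where

-- (⇒) holds for every transition system: by induction on the ordinal α, any
--     post-fixed point of the step functional is contained in ≲_α, so in
--     particular the witness of ≲^B is.
-- (⇐) The relation "t ≲_μ q for some μ > ht t" (trees on the left, processes
--     on the right) is itself a post-fixed point.  Indeed, if t has children
--     tᵢ and h = sup ht(tᵢ), then ht t = h + 1, so t ≲_μ q weakens (the
--     approximants are antitone) to t ≲_{h+2} q, i.e. one step matched by
--     pairs at level h + 1 > ht tᵢ, which again lie in the relation.

open import Defs
open import Level using (Lift; lift)
open import Data.Empty using (⊥)
open import Data.Unit using (tt)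
open import Data.Sum using (inj₁; inj₂)
open import Data.Product using (Σ; ∃; _×_; _,_; proj₁; proj₂)
open import Relation.Binary.PropositionalEquality using (refl)

≤ₒ-refl : ∀ x → x ≤ₒ x
≤ₒ-refl ozero      = ≤-zero
≤ₒ-refl (osuc x)   = ≤-suc (≤ₒ-refl x)
≤ₒ-refl (olim I f) = ≤-limiting (λ k → ≤-cocone k (≤ₒ-refl (f k)))

module Approximants {Act : Set} (S : LTS Act) where
  open LTS S renaming (Proc to P)

  Rel : Set₂
  Rel = P → P → Set₁

  _⊆_ : Rel → Rel → Set₁
  R ⊆ R' = ∀ x y → R x y → R' x y

  Step-mono : {R R' : Rel} → R ⊆ R' → Step S R ⊆ Step S R'
  Step-mono R⊆R' p q (forth , back) =
    (λ a p' p→p' → let (q' , q→q' , r) = forth a p' p→p' in q' , q→q' , R⊆R' _ _ r) ,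
    (λ p↓ → let (q↓ , match) = back p↓ in
      q↓ , λ a q' q→q' → let (p' , p→p' , r) = match a q' q→q' in p' , p→p' , R⊆R' _ _ r)

  ≲-antitone : ∀ {α β} → α ≤ₒ β → (λ p q → _≲[_]_ S p β q) ⊆ (λ p q → _≲[_]_ S p α q)
  ≲-antitone ≤-zero           p q _ = lift tt
  ≲-antitone (≤-trans α≤β β≤γ) p q r = ≲-antitone α≤β p q (≲-antitone β≤γ p q r)
  ≲-antitone (≤-suc α≤β)       p q r = Step-mono (≲-antitone α≤β) p q r
  ≲-antitone (≤-cocone k α≤fk) p q r = ≲-antitone α≤fk p q (r k)
  ≲-antitone (≤-limiting f≤β)  p q r = λ i → ≲-antitone (f≤β i) p q r

  postfixed⊆≲ : (R : Rel) → R ⊆ Step S R → ∀ α → R ⊆ (λ p q → _≲[_]_ S p α q)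
  postfixed⊆≲ R post ozero      x y r = lift tt
  postfixed⊆≲ R post (osuc α)   x y r = Step-mono (postfixed⊆≲ R post α) x y (post x y r)
  postfixed⊆≲ R post (olim I f) x y r = λ i → postfixed⊆≲ R post (f i) x y r

  ≲B⇒≲[_] : ∀ α {p q} → _≲B_ S p q → _≲[_]_ S p α q
  ≲B⇒≲[ α ] (R , post , r) = postfixed⊆≲ R post α _ _ r

module TreesBelowProcesses {Act : Set} (S : LTS Act) where
  U : LTS Act
  U = STLTS Act ⊎ᴸ S

  open Approximants U
  open LTS U using (_⟶[_]_; _↓)

  BelowAboveHeight : Rel
  BelowAboveHeight (inj₁ t) (inj₂ q) = Σ Ord λ μ → (ht t <ₒ μ) × _≲[_]_ U (inj₁ t) μ (inj₂ q)
  BelowAboveHeight _        _        = Lift _ ⊥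

  child-ht< : ∀ {I} (t : I → ST Act) i → ht (t i) <ₒ osuc (olim I (λ j → ht (t j)))
  child-ht< t i = ≤-suc (≤-cocone i (≤ₒ-refl _))

  BelowAboveHeight-postfixed : BelowAboveHeight ⊆ Step U BelowAboveHeight
  BelowAboveHeight-postfixed (inj₁ (node I a t b)) (inj₂ q) (μ , ht<μ , below) = forth , back
    where
    h : Ord
    h = olim I (λ i → ht (t i))

    -- ht (node …) = h + 1 < μ, so one step is matched at level h + 1.
    step : Step U (λ x y → _≲[_]_ U x (osuc h) y) (inj₁ (node I a t b)) (inj₂ q)
    step = ≲-antitone ht<μ _ _ below

    -- A move of the tree goes to a child tᵢ; the matching move of q is in the
    -- right-hand component, and the pair is related at level h + 1 > ht tᵢ.
    forth : ∀ c p' → inj₁ (node I a t b) ⟶[ c ] p'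
          → ∃ λ q' → inj₂ q ⟶[ c ] q' × BelowAboveHeight p' q'
    forth c (inj₁ t') t→t' with proj₁ step c (inj₁ t') t→t' | t→t'
    ... | inj₂ q' , q→q' , r | i , _ , refl = inj₂ q' , q→q' , (osuc h , child-ht< t i , r)

    back : inj₁ (node I a t b) ↓
         → inj₂ q ↓
         × (∀ c q' → inj₂ q ⟶[ c ] q'
            → ∃ λ p' → inj₁ (node I a t b) ⟶[ c ] p' × BelowAboveHeight p' q')
    back t↓ with proj₂ step t↓
    ... | q↓ , match = q↓ , matchChild
      where
      matchChild : ∀ c q' → inj₂ q ⟶[ c ] q'
                 → ∃ λ p' → inj₁ (node I a t b) ⟶[ c ] p' × BelowAboveHeight p' q'
      matchChild c (inj₂ q') q→q' with match c (inj₂ q') q→q'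
      ... | inj₁ t' , t→t' , r with t→t'
      ...   | i , _ , refl = inj₁ (t i) , t→t' , (osuc h , child-ht< t i , r)

mainTheorem3 : {Act : Set} (S : LTS Act) (T : ST Act) (p : Proc S) (λ' : Ord)
    → ht T <ₒ λ'
    → (_≲B_ (STLTS Act ⊎ᴸ S) (inj₁ T) (inj₂ p) → _≲[_]_ (STLTS Act ⊎ᴸ S) (inj₁ T) λ' (inj₂ p))
    × (_≲[_]_ (STLTS Act ⊎ᴸ S) (inj₁ T) λ' (inj₂ p) → _≲B_ (STLTS Act ⊎ᴸ S) (inj₁ T) (inj₂ p))
mainTheorem3 {Act} S T p λ' ht<λ =
  ≲B⇒≲[ λ' ] ,
  (λ below → BelowAboveHeight , BelowAboveHeight-postfixed , (λ' , ht<λ , below))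
  where
  open Approximants (STLTS Act ⊎ᴸ S)
  open TreesBelowProcesses S
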